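{- Let $T$ and $T'$ be finite vertex-colored arborescences with vertex-colored Prüfer codes (VCPCs) $P$ and $P'$. There exists a vertex-colored isomorphism between $T$ and $T'$ if and only if $P=P'$.
   Context: A vertex-colored arborescence is a finite directed tree $T$ with a root $r$ such that every edge is directed away from $r$, together with a coloring $c:V(T)\to\mathbb{N}$ (not necessarily proper). A vertex-colored isomorphism is a bijection of vertex sets that maps directed edges exactly onto directed edges and preserves colors. For $v\in V(T)$, $T[v]$ is the subarborescence of $v$ and all its descendants. Arrays are compared lexicographically: $x<y$ iff there is an index $i$ with $x[j]=y[j]$ for all $j<i$ and either $x[i]<y[i]$ (entries being integers or arrays compared recursively), or $x$ has length $i$ while $y$ is longer. The array $\mathrm{L}\mathcal{D}_A$ is defined recursively: if $u$ has no children, $\mathrm{L}\mathcal{D}_A(T[u])=[[\,]]$; otherwise, list the children of $u$ as $n_1,\dots,n_k$ sorted so that $n_a$ precedes $n_b$ whenever $c(n_a)<c(n_b)$, or $c(n_a)=c(n_b)$ and $\mathrm{L}\mathcal{D}_A(T[n_a])<\mathrm{L}\mathcal{D}_A(T[n_b])$ (remaining ties broken arbitrarily), and set $\mathrm{L}\mathcal{D}_A(T[u])=[[c(n_1),\dots,c(n_k)]]+\mathrm{L}\mathcal{D}_A(T[n_1])+\cdots+\mathrm{L}\mathcal{D}_A(T[n_k])$ ($+$ is concatenation). Let $\phi:V(T)\to\{0,\dots,n-1\}$ ($n=|V(T)|$) assign to each vertex its position in the preorder depth-first traversal from the root in which the children of every vertex are visited in this sorted order. The VCPC of $T$ is the $2\times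 n$ array built as follows: for steps $i=0,\dots,n-2$, in the current tree remove the vertex of out-degree zero with smallest $\phi$-value, recording in column $i$ the value $\phi$ of its parent (first row) and its color (second row); in the last column $n-1$ record $\emptyset$ in the first row and the color of the root in the second row. -}

module Defs where

open import Data.Nat using (ℕ; zero; suc; _<_; _≤_; _∸_)
open import Data.Fin using (Fin; toℕ)
open import Data.Maybe using (Maybe; just; nothing; maybe)
open import Data.List using (List; []; _∷_; map; concat; length; lookup; _++_; [_])
open import Data.List.Membership.Propositional using (_∈_; _∉_)
open import Data.List.Relation.Unary.Unique.Propositional using (Unique)
open import Data.List.Relation.Unary.AllPairs using (AllPairs)
open import Data.List.Relation.Binary.Pointwise using (Pointwise)
open import Data.List.Relation.Binary.Lex.Strict using (Lex-<)
open import Data.Product using (Σ; ∃; _×_; _,_)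
open import Data.Sum using (_⊎_)
open import Relation.Nullary using (¬_)
open import Relation.Binary.PropositionalEquality using (_≡_)
open import Function.Bundles using (_⇔_; _⤖_; Bijection)

-- Vertices are Fin size; the directed edges are exactly the pairs
-- (p , v) with parent v ≡ just p.  The root has no parent and every
-- vertex reaches the root by iterating 'parent' (this forces all other
-- vertices to have exactly one parent and excludes cycles), so these are
-- exactly the finite rooted trees with all edges directed away from the root.

anc : {n : ℕ} → (Fin n → Maybe (Fin n)) → ℕ → Fin n → Maybe (Fin n)
anc par zero    v = just v
anc par (suc k) v = maybe (anc par k) nothing (par v)

record Arb : Set where
  field
    size   : ℕ
    root   : Fin size
    parent : Fin size → Maybe (Fin size)
    color  : Fin size → ℕ
    root-parent  : parent root ≡ nothing
    reaches-root : ∀ v → ∃ λ k → anc parent k v ≡ just root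

open Arb

Edge : (T : Arb) → Fin (size T) → Fin (size T) → Set
Edge T u v = parent T v ≡ just u

record ColIso (T T' : Arb) : Set where
  field
    bij        : Fin (size T) ⤖ Fin (size T')
  f : Fin (size T) → Fin (size T')
  f = Bijection.to bij
  field
    edges      : ∀ u v → Edge T u v ⇔ Edge T' (f u) (f v)
    colors     : ∀ v → color T' (f v) ≡ color T v

LexNat : List ℕ → List ℕ → Set
LexNat = Lex-< _≡_ _<_

LexLD : List (List ℕ) → List (List ℕ) → Set
LexLD = Lex-< _≡_ LexNat

module _ (T : Arb) where
  private
    V = Fin (size T)

  Ordering : Set
  Ordering = V → List V

  data LDR (ord : Ordering) : V → List (List ℕ) → Set where
    ld : ∀ {u Ls} → Pointwise (LDR ord) (ord u) Ls →
         LDR ord u (map (color T) (ord u) ∷ concat Ls)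

  NotBefore : Ordering → V → V → Set
  NotBefore ord a b = ∀ La Lb → LDR ord a La → LDR ord b Lb →
    ¬ (color T b < color T a ⊎ (color T b ≡ color T a × LexLD Lb La))

  -- ord lists exactly the children of each vertex, each once, sorted by
  -- (colour, LD_A) with ties broken arbitrarily.
  record ValidOrdering (ord : Ordering) : Set where
    field
      children : ∀ u w → (w ∈ ord u) ⇔ Edge T u w
      distinct : ∀ u → Unique (ord u)
      sorted   : ∀ u → AllPairs (NotBefore ord) (ord u)

  data Pre (ord : Ordering) : V → List V → Set where
    pre : ∀ {u Ls} → Pointwise (Pre ord) (ord u) Ls → Pre ord u (u ∷ concat Ls)

  PositionIn : List V → V → ℕ → Set
  PositionIn xs v k = Σ (Fin (length xs)) λ i → lookup xs i ≡ v × toℕ i ≡ k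

  IsLeafIn : List V → V → Set
  IsLeafIn gone v = v ∉ gone × (∀ w → Edge T v w → w ∈ gone)

  data Removal (φ : V → ℕ) : List V → ℕ → List V → Set where
    done : ∀ {gone} → Removal φ gone zero []
    step : ∀ {gone k rs} v → IsLeafIn gone v →
           (∀ w → IsLeafIn gone w → φ v ≤ φ w) →
           Removal φ (v ∷ gone) k rs → Removal φ gone (suc k) (v ∷ rs)

  -- a column of the code: (first row, second row); nothing encodes ∅
  Column : Set
  Column = Maybe ℕ × ℕ

  column : (V → ℕ) → V → Column
  column φ v = (maybe (λ p → just (φ p)) nothing (parent T v) , color T v)

  IsVCPC : List Column → Set
  IsVCPC P =
    Σ Ordering λ ord → ValidOrdering ord ×
    Σ (List V) λ pr → Pre ord (root T) pr ×
    Σ (V → ℕ) λ φ → (∀ v → PositionIn pr v (φ v)) ×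
    Σ (List V) λ rs → Removal φ [] (size T ∸ 1) rs ×
    P ≡ map (column φ) rs ++ [ (nothing , color T (root T)) ]

{-# OPTIONS --safe #-}
-- Both directions go through the relabelling that identifies the vertex at
-- preorder position ℓ in T with the vertex at position ℓ in T′.
--
-- (⇒) An isomorphism preserves LD_A: corresponding vertices have children with
-- the same multiset of (colour, LD_A) keys, listed sorted by key. LD_A arrays
-- are prefix-free, so equal LD_A at the roots makes the two preorder traversals
-- agree position by position, in colour and in the position of the parent. The
-- relabelling is then an isomorphism preserving φ, so it carries one leaf
-- removal sequence to the other and the codes coincide.
--
-- (⇐) As for Prüfer codes, the label removed at each step is determined by the
-- code and the labels removed before: it is the least label that is not yet
-- removed and is not the parent label of any remaining column. Equal codes thus
-- give equal removal sequences of labels, so the relabelling preserves every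
-- column, i.e. parents and colours.
module Submission where

open import Defs
open import Data.Nat using (ℕ; zero; suc; _<_; _≤_; _∸_; _+_; _*_; s≤s; z≤n)
open import Data.Nat.Properties
  using ( ≤-trans; <-irrefl; ≤-reflexive; n<1+n; m≤m*n; m<m+n; +-suc; +-comm; m≤n⇒∃[o]m+o≡n
        ; ≤-total; ≤-antisym; <-cmp; suc-injective; module ≤-Reasoning)
open import Data.Fin using (Fin; toℕ; fromℕ<; zero; suc)
import Data.Fin.Properties as Fin
open import Data.Maybe using (Maybe; just; nothing; maybe)
import Data.Maybe as Maybe
import Data.Maybe.Properties as Maybe
open import Data.List using (List; []; _∷_; map; concat; length; lookup; _++_; [_]; zip)
import Data.List.Properties as List
open import Data.List.Membership.Propositional using (_∈_; _∉_)
open import Data.List.Membership.Propositional.Properties using (∈-lookup; ∈-++⁻; ∈-++⁺ˡ; ∈-++⁺ʳ; ∈-map⁺; ∈-map⁻)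
open import Data.List.Membership.Propositional.Properties.WithK using (unique∧set⇒bag)
open import Data.List.Relation.Binary.BagAndSetEquality using (∼bag⇒↭)
open import Data.List.Relation.Binary.Permutation.Propositional using (_↭_; ↭-sym)
open import Data.List.Relation.Binary.Permutation.Propositional.Properties using (∈-resp-↭; ↭-length; drop-∷)
  renaming (map⁺ to ↭-map⁺)
open import Data.List.Relation.Binary.Pointwise using (Pointwise; []; _∷_; Pointwise-≡⇒≡; ≡⇒Pointwise-≡)
open import Data.List.Relation.Binary.Disjoint.Propositional using (Disjoint)
open import Data.List.Relation.Unary.Any using (here; there; index)
open import Data.List.Relation.Unary.Any.Properties using (lookup-index)
open import Data.List.Relation.Unary.All as All using (All; []; _∷_)
open import Data.List.Relation.Unary.All.Properties using (++⁺)
open import Data.List.Relation.Unary.AllPairs as AllPairs using (AllPairs; []; _∷_)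
import Data.List.Relation.Unary.AllPairs.Properties as AllPairs
open import Data.List.Relation.Unary.Unique.Propositional using (Unique)
import Data.List.Relation.Unary.Unique.Propositional.Properties as Unique
open import Data.List.Relation.Binary.Lex.Strict using (Lex-<)
import Data.List.Relation.Binary.Lex.Strict as Lex
open import Relation.Binary.Definitions using (Trichotomous; tri<; tri≈; tri>)
open import Data.Product using (Σ; ∃; ∃₂; _×_; _,_; proj₁; proj₂)
open import Data.Sum using (_⊎_; inj₁; inj₂)
open import Data.Empty using (⊥-elim)
open import Relation.Nullary using (¬_; yes; no)
open import Relation.Binary.PropositionalEquality
  using (_≡_; _≢_; refl; sym; trans; cong; cong₂; subst; subst₂; module ≡-Reasoning)
open import Function using (_∘_)
open import Function.Bundles using (_⇔_; mk⇔; Equivalence; Bijection; mk⤖)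
open import Function.Properties.Bijection using () renaming (sym-≡ to ⤖-sym)

module _ {A : Set} where

  lookup-injective : ∀ {xs : List A} → Unique xs → ∀ i j → lookup xs i ≡ lookup xs j → i ≡ j
  lookup-injective {_ ∷ _} _          zero    zero    _ = refl
  lookup-injective         (x∉ ∷ _)   zero    (suc j) e = ⊥-elim (All.lookup x∉ (∈-lookup j) e)
  lookup-injective         (x∉ ∷ _)   (suc i) zero    e = ⊥-elim (All.lookup x∉ (∈-lookup i) (sym e))
  lookup-injective         (_ ∷ uxs)  (suc i) (suc j) e = cong suc (lookup-injective uxs i j e)

  unique-↭ : ∀ {xs ys : List A} → Unique xs → Unique ys → (∀ {z} → z ∈ xs ⇔ z ∈ ys) → xs ↭ ys
  unique-↭ uxs uys xs≈ys = ∼bag⇒↭ (unique∧set⇒bag uxs uys xs≈ys)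

module _ {A B : Set} where

  zip-++ : ∀ (xs : List A) (ys : List B) {xs₂ ys₂} → length xs ≡ length ys →
    zip (xs ++ xs₂) (ys ++ ys₂) ≡ zip xs ys ++ zip xs₂ ys₂
  zip-++ []       []       _   = refl
  zip-++ (x ∷ xs) (y ∷ ys) len = cong ((x , y) ∷_) (zip-++ xs ys (suc-injective len))

  ∈-zip-lookup : ∀ (xs : List A) (ys : List B) i j → toℕ i ≡ toℕ j → (lookup xs i , lookup ys j) ∈ zip xs ys
  ∈-zip-lookup (x ∷ xs) (y ∷ ys) zero    zero    _   = here refl
  ∈-zip-lookup (x ∷ xs) (y ∷ ys) (suc i) (suc j) i≡j = there (∈-zip-lookup xs ys i j (suc-injective i≡j))

  ∈-zip⁻ : ∀ (xs : List A) (ys : List B) {a b} → (a , b) ∈ zip xs ys →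
    ∃₂ λ i j → toℕ i ≡ toℕ j × lookup xs i ≡ a × lookup ys j ≡ b
  ∈-zip⁻ (x ∷ xs) (y ∷ ys) (here refl) = zero , zero , refl , refl , refl
  ∈-zip⁻ (x ∷ xs) (y ∷ ys) (there ab∈) with i , j , i≡j , xᵢ≡a , yⱼ≡b ← ∈-zip⁻ xs ys ab∈ =
    suc i , suc j , cong suc i≡j , xᵢ≡a , yⱼ≡b

module _ {A B C : Set} {f : A → C} {g : B → C} where

  map-≡⇒∈ : ∀ {xs ys} → map f xs ≡ map g ys → ∀ {x} → x ∈ xs → ∃ λ y → y ∈ ys × g y ≡ f x
  map-≡⇒∈ {_ ∷ _} {y ∷ _} e (here refl) = y , here refl , sym (List.∷-injectiveˡ e)
  map-≡⇒∈ {_ ∷ _} {_ ∷ _} e (there x∈) with y , y∈ , gy≡fx ← map-≡⇒∈ (List.∷-injectiveʳ e) x∈ =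
    y , there y∈ , gy≡fx

module _ {A B : Set} {f g : A → B} where

  map-≡⇒≗ : ∀ {xs} → map f xs ≡ map g xs → ∀ {x} → x ∈ xs → f x ≡ g x
  map-≡⇒≗ e (here refl) = List.∷-injectiveˡ e
  map-≡⇒≗ e (there x∈)  = map-≡⇒≗ (List.∷-injectiveʳ e) x∈

module _ {n : ℕ} where
  open import Data.List.Membership.DecPropositional (Fin._≟_ {n}) using (_∈?_)

  unique⇒length≤ : ∀ {xs : List (Fin n)} → Unique xs → length xs ≤ n
  unique⇒length≤ uxs = Fin.injective⇒≤ (λ {i} {j} → lookup-injective uxs i j)

  covering⇒length≥ : ∀ {xs : List (Fin n)} → (∀ v → v ∈ xs) → n ≤ length xs
  covering⇒length≥ {xs} cover = Fin.injective⇒≤ {f = λ v → index (cover v)} λ {v} {w} e →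
    trans (lookup-index (cover v)) (trans (cong (lookup xs) e) (sym (lookup-index (cover w))))

  unique∧length≡⇒covering : ∀ {xs : List (Fin n)} → Unique xs → length xs ≡ n → ∀ v → v ∈ xs
  unique∧length≡⇒covering {xs} uxs len v with v ∈? xs
  ... | yes v∈xs = v∈xs
  ... | no  v∉xs = ⊥-elim (<-irrefl refl (≤-trans (s≤s (≤-reflexive (sym len))) (unique⇒length≤ (v∉ ∷ uxs))))
    where
    v∉ : All (v ≢_) xs
    v∉ = All.tabulate λ w∈xs v≡w → v∉xs (subst (_∈ xs) (sym v≡w) w∈xs)

Sorted : {K : Set} → (K → K → Set) → List K → Set
Sorted _<_ = AllPairs (λ a b → ¬ b < a)

module _ {K : Set} {_<_ : K → K → Set} (≮-antisym : ∀ {a b} → ¬ a < b → ¬ b < a → a ≡ b) where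

  sorted-↭-head : ∀ {x y xs ys} → x ∷ xs ↭ y ∷ ys → All (λ b → ¬ b < x) xs → All (λ b → ¬ b < y) ys → x ≡ y
  sorted-↭-head p x≤xs y≤ys with ∈-resp-↭ p (here refl) | ∈-resp-↭ (↭-sym p) (here refl)
  ... | here x≡y | _        = x≡y
  ... | _        | here y≡x = sym y≡x
  ... | there x∈ | there y∈ = ≮-antisym (All.lookup y≤ys x∈) (All.lookup x≤xs y∈)

  sorted-↭⇒≡ : ∀ {xs ys} → xs ↭ ys → Sorted _<_ xs → Sorted _<_ ys → xs ≡ ys
  sorted-↭⇒≡ {[]}     {[]}     _ _ _ = refl
  sorted-↭⇒≡ {[]}     {_ ∷ _}  p _ _ with () ← ↭-length p
  sorted-↭⇒≡ {_ ∷ _}  {[]}     p _ _ with () ← ↭-length p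
  sorted-↭⇒≡ {x ∷ xs} {y ∷ ys} p (x≤xs ∷ sxs) (y≤ys ∷ sys) with refl ← sorted-↭-head p x≤xs y≤ys =
    cong (x ∷_) (sorted-↭⇒≡ (drop-∷ p) sxs sys)

lex-trichotomous : {A : Set} {_<_ : A → A → Set} → Trichotomous _≡_ _<_ → Trichotomous _≡_ (Lex-< _≡_ _<_)
lex-trichotomous tri xs ys with Lex.<-compare sym tri xs ys
... | tri< xs<ys xs≉ys ys≮xs = tri< xs<ys (λ xs≡ys → xs≉ys (≡⇒Pointwise-≡ xs≡ys)) ys≮xs
... | tri≈ xs≮ys xs≋ys ys≮xs = tri≈ xs≮ys (Pointwise-≡⇒≡ xs≋ys) ys≮xs
... | tri> xs≮ys xs≉ys ys<xs = tri> xs≮ys (λ xs≡ys → xs≉ys (≡⇒Pointwise-≡ xs≡ys)) ys<xs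

SortKey : Set
SortKey = ℕ × List (List ℕ)

_≺_ : SortKey → SortKey → Set
(c , L) ≺ (c′ , L′) = c < c′ ⊎ (c ≡ c′ × LexLD L L′)

≺-≮-antisym : ∀ {a b} → ¬ a ≺ b → ¬ b ≺ a → a ≡ b
≺-≮-antisym {c , L} {c′ , L′} a⊀b b⊀a with <-cmp c c′
... | tri< c<c′ _ _ = ⊥-elim (a⊀b (inj₁ c<c′))
... | tri> _ _ c′<c = ⊥-elim (b⊀a (inj₁ c′<c))
... | tri≈ _ refl _ with lex-trichotomous (lex-trichotomous <-cmp) L L′
...   | tri< L<L′ _ _ = ⊥-elim (a⊀b (inj₂ (refl , L<L′)))
...   | tri> _ _ L′<L = ⊥-elim (b⊀a (inj₂ (refl , L′<L)))
...   | tri≈ _ refl _ = refl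

module Tree (T : Arb) where
  open Arb T

  private
    V : Set
    V = Fin size

  -- The subtraction is not truncated: root inhabits Fin size.
  size-suc : suc (size ∸ 1) ≡ size
  size-suc with size | root
  ... | suc _ | _ = refl

  anc-+ : ∀ a b v → anc parent (a + b) v ≡ maybe (anc parent b) nothing (anc parent a v)
  anc-+ zero    b v = refl
  anc-+ (suc a) b v with parent v
  ... | nothing = refl
  ... | just p  = anc-+ a b p

  anc-past-root : ∀ {a b u} → anc parent a u ≡ just root → a < b → anc parent b u ≡ nothing
  anc-past-root {a} {u = u} a↦root a<b with j , refl ← m≤n⇒∃[o]m+o≡n a<b = begin
    anc parent (suc a + j) u                              ≡⟨ cong (λ t → anc parent t u) (sym (+-suc a j)) ⟩
    anc parent (a + suc j) u                              ≡⟨ anc-+ a (suc j) u ⟩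
    maybe (anc parent (suc j)) nothing (anc parent a u)   ≡⟨ cong (maybe (anc parent (suc j)) nothing) a↦root ⟩
    maybe (anc parent j) nothing (parent root)            ≡⟨ cong (maybe (anc parent j) nothing) root-parent ⟩
    nothing                                               ∎
    where open ≡-Reasoning

  anc-periodic : ∀ {m u} → anc parent (suc m) u ≡ just u → ∀ t → anc parent (t * suc m) u ≡ just u
  anc-periodic         cycle zero    = refl
  anc-periodic {m} {u} cycle (suc t) = begin
    anc parent (suc m + t * suc m) u                                   ≡⟨ anc-+ (suc m) (t * suc m) u ⟩
    maybe (anc parent (t * suc m)) nothing (anc parent (suc m) u)       ≡⟨ cong (maybe (anc parent (t * suc m)) nothing) cycle ⟩
    anc parent (t * suc m) u                                           ≡⟨ anc-periodic cycle t ⟩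
    just u                                                             ∎
    where open ≡-Reasoning

  acyclic : ∀ m u → anc parent (suc m) u ≢ just u
  acyclic m u cycle with k , u↦root ← reaches-root u with () ←
    trans (sym (anc-periodic {m} cycle (suc k))) (anc-past-root u↦root (≤-trans (n<1+n k) (m≤m*n (suc k) (suc m))))

  parentless⇒root : ∀ v → parent v ≡ nothing → v ≡ root
  parentless⇒root v pv with reaches-root v
  ... | zero  , refl = refl
  ... | suc k , e rewrite pv with () ← e

  _≼_ : V → V → Set
  w ≼ x = ∃ λ k → anc parent k w ≡ just x

  ≼-refl : ∀ {w} → w ≼ w
  ≼-refl = 0 , refl

  ≼-parent : ∀ {w c u} → w ≼ c → parent c ≡ just u → w ≼ u
  ≼-parent {w} {c} (k , w↦c) pc = k + 1 , (begin
    anc parent (k + 1) w                             ≡⟨ anc-+ k 1 w ⟩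
    maybe (anc parent 1) nothing (anc parent k w)    ≡⟨ cong (maybe (anc parent 1) nothing) w↦c ⟩
    maybe (anc parent 0) nothing (parent c)          ≡⟨ cong (maybe (anc parent 0) nothing) pc ⟩
    anc parent 0 _                                   ∎)
    where open ≡-Reasoning

  anc-≤⇒≼ : ∀ {a b w x y} → a ≤ b → anc parent a w ≡ just x → anc parent b w ≡ just y → x ≼ y
  anc-≤⇒≼ {a} {w = w} a≤b w↦x w↦y with j , refl ← m≤n⇒∃[o]m+o≡n a≤b =
    j , trans (sym (cong (maybe (anc parent j) nothing) w↦x)) (trans (sym (anc-+ a j w)) w↦y)

  ≼-connected : ∀ {w x y} → w ≼ x → w ≼ y → x ≼ y ⊎ y ≼ x
  ≼-connected (a , w↦x) (b , w↦y) with ≤-total a b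
  ... | inj₁ a≤b = inj₁ (anc-≤⇒≼ a≤b w↦x w↦y)
  ... | inj₂ b≤a = inj₂ (anc-≤⇒≼ b≤a w↦y w↦x)

  child-⋠ : ∀ {c u} → parent c ≡ just u → ¬ u ≼ c
  child-⋠ {u = u} pc u≼c@(k , _) =
    acyclic k u (trans (cong (λ t → anc parent t u) (+-comm 1 k)) (proj₂ (≼-parent u≼c pc)))

  sibling-≼⇒≡ : ∀ {c₁ c₂ u} → parent c₁ ≡ just u → parent c₂ ≡ just u → c₁ ≼ c₂ → c₁ ≡ c₂
  sibling-≼⇒≡ p₁ p₂ (zero , refl) = refl
  sibling-≼⇒≡ p₁ p₂ (suc d , c₁↦c₂) =
    ⊥-elim (child-⋠ p₂ (d , trans (sym (cong (maybe (anc parent d) nothing) p₁)) c₁↦c₂))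

  siblings-disjoint : ∀ {c₁ c₂ u w} → parent c₁ ≡ just u → parent c₂ ≡ just u → c₁ ≢ c₂ →
    w ≼ c₁ → ¬ w ≼ c₂
  siblings-disjoint p₁ p₂ c₁≢c₂ w≼c₁ w≼c₂ with ≼-connected w≼c₁ w≼c₂
  ... | inj₁ c₁≼c₂ = c₁≢c₂ (sibling-≼⇒≡ p₁ p₂ c₁≼c₂)
  ... | inj₂ c₂≼c₁ = c₁≢c₂ (sym (sibling-≼⇒≡ p₂ p₁ c₂≼c₁))

  module _ {ψ : V → ℕ} where

    removal-length : ∀ {G k rs} → Removal T ψ G k rs → length rs ≡ k
    removal-length done           = refl
    removal-length (step _ _ _ r) = cong suc (removal-length r)

    removal-fresh : ∀ {G k rs} → Removal T ψ G k rs → All (_∉ G) rs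
    removal-fresh done                   = []
    removal-fresh (step v (v∉G , _) _ r) = v∉G ∷ All.map (λ w∉ w∈G → w∉ (there w∈G)) (removal-fresh r)

    removal-unique : ∀ {G k rs} → Removal T ψ G k rs → Unique rs
    removal-unique done           = []
    removal-unique (step v _ _ r) = All.map (λ w∉ v≡w → w∉ (here (sym v≡w))) (removal-fresh r) ∷ removal-unique r

    removal-deterministic : (∀ {v w} → ψ v ≡ ψ w → v ≡ w) →
      ∀ {G k rs rs′} → Removal T ψ G k rs → Removal T ψ G k rs′ → rs ≡ rs′
    removal-deterministic ψ-inj done done = refl
    removal-deterministic ψ-inj (step v leaf min r) (step v′ leaf′ min′ r′)
      with refl ← ψ-inj (≤-antisym (min v′ leaf′) (min′ v leaf)) =
      cong (v ∷_) (removal-deterministic ψ-inj r r′)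

  Exhaust : List V → List V → Set
  Exhaust G rs = ∀ u → u ∈ G ⊎ u ∈ rs ⊎ u ≡ root

  exhaust-step : ∀ {G v rs} → Exhaust G (v ∷ rs) → Exhaust (v ∷ G) rs
  exhaust-step exhaust u with exhaust u
  ... | inj₁ u∈G                = inj₁ (there u∈G)
  ... | inj₂ (inj₁ (here u≡v))  = inj₁ (here u≡v)
  ... | inj₂ (inj₁ (there u∈rs)) = inj₂ (inj₁ u∈rs)
  ... | inj₂ (inj₂ u≡root)      = inj₂ (inj₂ u≡root)

  ChildClosed : List V → Set
  ChildClosed G = ∀ {u c} → u ∈ G → parent c ≡ just u → c ∈ G

  child-closed-covering : ∀ {G} → ChildClosed G → (∀ c → parent c ≡ just root → c ∈ G) → ∀ v → v ∈ root ∷ G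
  child-closed-covering {G} closed root-children v = climb (proj₁ (reaches-root v)) v (proj₂ (reaches-root v))
    where
    climb : ∀ k v → anc parent k v ≡ just root → v ∈ root ∷ G
    climb zero    v refl = here refl
    climb (suc k) v v↦root with parent v in pv
    ... | nothing with () ← v↦root
    ... | just p with climb k p v↦root
    ...   | here refl = there (root-children v pv)
    ...   | there p∈G = there (closed p∈G pv)

  root-not-removed : ∀ {ψ G k rs} → Removal T ψ G k rs → ChildClosed G → length G + k ≡ size ∸ 1 → root ∉ rs
  root-not-removed {G = G} {suc k} (step _ (_ , children-gone) _ _) closed len (here refl) =
    <-irrefl refl (begin-strict
      size                   ≤⟨ covering⇒length≥ (child-closed-covering closed children-gone) ⟩
      suc (length G)         <⟨ s≤s (m<m+n (length G) (s≤s z≤n)) ⟩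
      suc (length G + suc k) ≡⟨ cong suc len ⟩
      suc (size ∸ 1)         ≡⟨ size-suc ⟩
      size                   ∎)
    where open ≤-Reasoning
  root-not-removed {G = G} (step v (_ , children-gone) _ r) closed len (there root∈) =
    root-not-removed r closed′ (trans (sym (+-suc (length G) _)) len) root∈
    where
    closed′ : ChildClosed (v ∷ G)
    closed′ (here refl) pc = there (children-gone _ pc)
    closed′ (there u∈G) pc = there (closed u∈G pc)

  module Traversal {ord : Ordering T} (valid : ValidOrdering T ord) where
    open ValidOrdering valid

    child-parent : ∀ {u c} → c ∈ ord u → parent c ≡ just u
    child-parent {u} {c} = Equivalence.to (children u c)

    private
      Below : V → List V → Set
      Below c xs = All (_≼ c) xs

      below-children : ∀ {u cs xss} {P : V → Set} → (∀ {c w} → parent c ≡ just u → w ≼ c → P w) →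
        All (λ c → parent c ≡ just u) cs → Pointwise Below cs xss → All P (concat xss)
      below-children f []         []         = []
      below-children f (pc ∷ pcs) (≼c ∷ ≼cs) = ++⁺ (All.map (f pc) ≼c) (below-children f pcs ≼cs)

      subtrees-disjoint : ∀ {u cs xss} → All (λ c → parent c ≡ just u) cs → Unique cs →
        Pointwise Below cs xss → AllPairs Disjoint xss
      subtrees-disjoint []         []          []         = []
      subtrees-disjoint {u} (pc ∷ pcs) (c≢cs ∷ ucs) (≼c ∷ ≼cs) =
        apart pcs c≢cs ≼cs ∷ subtrees-disjoint pcs ucs ≼cs
        where
        apart : ∀ {cs xss} → All (λ c → parent c ≡ just u) cs → All (_ ≢_) cs →
          Pointwise Below cs xss → All (Disjoint _) xss
        apart []           []          []           = []
        apart (pc′ ∷ pcs′) (c≢ ∷ c≢s) (≼c′ ∷ ≼cs′) =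
          (λ (w∈ , w∈′) → siblings-disjoint pc pc′ c≢ (All.lookup ≼c w∈) (All.lookup ≼c′ w∈′))
          ∷ apart pcs′ c≢s ≼cs′

    mutual
      traversal-≼ : ∀ {u xs} → Pre T ord u xs → All (_≼ u) xs
      traversal-≼ (pre ps) =
        ≼-refl ∷ below-children (λ pc w≼c → ≼-parent w≼c pc) (All.tabulate child-parent) (subtraversals-≼ ps)

      subtraversals-≼ : ∀ {cs xss} → Pointwise (Pre T ord) cs xss → Pointwise Below cs xss
      subtraversals-≼ []       = []
      subtraversals-≼ (p ∷ ps) = traversal-≼ p ∷ subtraversals-≼ ps

    mutual
      traversal-unique : ∀ {u xs} → Pre T ord u xs → Unique xs
      traversal-unique {u} (pre ps) =
        below-children (λ pc w≼c u≡w → child-⋠ pc (subst (_≼ _) (sym u≡w) w≼c)) children-parents (subtraversals-≼ ps)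
        ∷ Unique.concat⁺ (subtraversals-unique ps) (subtrees-disjoint children-parents (distinct u) (subtraversals-≼ ps))
        where
        children-parents = All.tabulate child-parent

      subtraversals-unique : ∀ {cs xss} → Pointwise (Pre T ord) cs xss → All Unique xss
      subtraversals-unique []       = []
      subtraversals-unique (p ∷ ps) = traversal-unique p ∷ subtraversals-unique ps

    mutual
      traversal-functional : ∀ {u xs ys} → Pre T ord u xs → Pre T ord u ys → xs ≡ ys
      traversal-functional (pre ps) (pre qs) = cong (λ xss → _ ∷ concat xss) (subtraversals-functional ps qs)

      subtraversals-functional : ∀ {cs xss yss} → Pointwise (Pre T ord) cs xss → Pointwise (Pre T ord) cs yss → xss ≡ yss
      subtraversals-functional []       []       = refl
      subtraversals-functional (p ∷ ps) (q ∷ qs) = cong₂ _∷_ (traversal-functional p q) (subtraversals-functional ps qs)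

    mutual
      ld-functional : ∀ {u L M} → LDR T ord u L → LDR T ord u M → L ≡ M
      ld-functional (ld ps) (ld qs) = cong (λ Ls → _ ∷ concat Ls) (lds-functional ps qs)

      lds-functional : ∀ {cs Ls Ms} → Pointwise (LDR T ord) cs Ls → Pointwise (LDR T ord) cs Ms → Ls ≡ Ms
      lds-functional []       []       = refl
      lds-functional (p ∷ ps) (q ∷ qs) = cong₂ _∷_ (ld-functional p q) (lds-functional ps qs)

    mutual
      traversal⇒ld : ∀ {u xs} → Pre T ord u xs → ∃ (LDR T ord u)
      traversal⇒ld (pre ps) = _ , ld (proj₂ (subtraversals⇒lds ps))

      subtraversals⇒lds : ∀ {cs xss} → Pointwise (Pre T ord) cs xss → ∃ (Pointwise (LDR T ord) cs)
      subtraversals⇒lds []       = [] , []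
      subtraversals⇒lds (p ∷ ps) = _ , proj₂ (traversal⇒ld p) ∷ proj₂ (subtraversals⇒lds ps)

    mutual
      traversal-∈ : ∀ {u xs w} → Pre T ord u xs → w ∈ xs → ∃ (Pre T ord w)
      traversal-∈ p@(pre _) (here refl) = _ , p
      traversal-∈ (pre ps)  (there w∈)  = subtraversals-∈ ps w∈

      subtraversals-∈ : ∀ {cs xss w} → Pointwise (Pre T ord) cs xss → w ∈ concat xss → ∃ (Pre T ord w)
      subtraversals-∈ (_∷_ {y = xs} p ps) w∈ with ∈-++⁻ xs w∈
      ... | inj₁ w∈xs  = traversal-∈ p w∈xs
      ... | inj₂ w∈xss = subtraversals-∈ ps w∈xss

record Encoding (T : Arb) : Set where
  open Arb T
  field
    ord        : Ordering T
    valid      : ValidOrdering T ord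
    traversal  : List (Fin size)
    preorder   : Pre T ord root traversal
    φ          : Fin size → ℕ
    φ-position : ∀ v → PositionIn T traversal v (φ v)
    removed    : List (Fin size)
    removal    : Removal T φ [] (size ∸ 1) removed

  code : List (Column T)
  code = map (column T φ) removed ++ [ (nothing , color root) ]

IsVCPC⇒Encoding : ∀ {T P} → IsVCPC T P → Σ (Encoding T) λ E → P ≡ Encoding.code E
IsVCPC⇒Encoding (ord , valid , traversal , preorder , φ , φ-position , removed , removal , P≡code) =
  record { ord = ord ; valid = valid ; traversal = traversal ; preorder = preorder ; φ = φ
         ; φ-position = φ-position ; removed = removed ; removal = removal } ,
  P≡code

module EncodingFacts {T : Arb} (E : Encoding T) where
  open Arb T
  open Encoding E
  open Tree T
  open Traversal valid public

  private
    V : Set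
    V = Fin size

  ∈-traversal : ∀ v → v ∈ traversal
  ∈-traversal v with i , lookup≡v , _ ← φ-position v = subst (_∈ traversal) lookup≡v (∈-lookup i)

  φ-injective : ∀ {v w} → φ v ≡ φ w → v ≡ w
  φ-injective {v} {w} φv≡φw with i , lookup≡v , i≡φv ← φ-position v | j , lookup≡w , j≡φw ← φ-position w =
    trans (sym lookup≡v)
      (trans (cong (lookup traversal) (Fin.toℕ-injective (trans i≡φv (trans φv≡φw (sym j≡φw))))) lookup≡w)

  φ-lookup : ∀ i {v} → lookup traversal i ≡ v → φ v ≡ toℕ i
  φ-lookup i {v} lookup≡v with j , lookup≡v′ , j≡φv ← φ-position v =
    trans (sym j≡φv) (cong toℕ (lookup-injective (traversal-unique preorder) j i (trans lookup≡v′ (sym lookup≡v))))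

  traversal-length : length traversal ≡ size
  traversal-length = ≤-antisym (unique⇒length≤ (traversal-unique preorder)) (covering⇒length≥ ∈-traversal)

  φ<size : ∀ v → φ v < size
  φ<size v with i , _ , i≡φv ← φ-position v = subst₂ _<_ i≡φv traversal-length (Fin.toℕ<n i)

  vertex : ∀ ℓ → ℓ < size → V
  vertex ℓ ℓ<size = lookup traversal (fromℕ< (subst (ℓ <_) (sym traversal-length) ℓ<size))

  φ-vertex : ∀ ℓ ℓ<size → φ (vertex ℓ ℓ<size) ≡ ℓ
  φ-vertex ℓ ℓ<size = trans (φ-lookup _ refl) (Fin.toℕ-fromℕ< _)

  φ-root : φ root ≡ 0
  φ-root with pre _ ← preorder = φ-lookup zero refl

  subtraversal : V → List V
  subtraversal v = proj₁ (traversal-∈ preorder (∈-traversal v))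

  subtraversal-pre : ∀ v → Pre T ord v (subtraversal v)
  subtraversal-pre v = proj₂ (traversal-∈ preorder (∈-traversal v))

  subtraversal-root : subtraversal root ≡ traversal
  subtraversal-root = traversal-functional (subtraversal-pre root) preorder

  pre⇒subtraversal : ∀ {u xs} → Pre T ord u xs → xs ≡ u ∷ concat (map subtraversal (ord u))
  pre⇒subtraversal {u} (pre ps) = cong (λ xss → u ∷ concat xss) (pointwise ps)
    where
    pointwise : ∀ {cs xss} → Pointwise (Pre T ord) cs xss → xss ≡ map subtraversal cs
    pointwise []       = refl
    pointwise (p ∷ ps) = cong₂ _∷_ (traversal-functional p (subtraversal-pre _)) (pointwise ps)

  subtraversal-≡ : ∀ u → subtraversal u ≡ u ∷ concat (map subtraversal (ord u))
  subtraversal-≡ u = pre⇒subtraversal (subtraversal-pre u)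

  ldA : V → List (List ℕ)
  ldA v = proj₁ (traversal⇒ld (subtraversal-pre v))

  ldA-LDR : ∀ v → LDR T ord v (ldA v)
  ldA-LDR v = proj₂ (traversal⇒ld (subtraversal-pre v))

  ldr⇒ldA : ∀ {u L} → LDR T ord u L → L ≡ map color (ord u) ∷ concat (map ldA (ord u))
  ldr⇒ldA {u} (ld ps) = cong (λ Ls → map color (ord u) ∷ concat Ls) (pointwise ps)
    where
    pointwise : ∀ {cs Ls} → Pointwise (LDR T ord) cs Ls → Ls ≡ map ldA cs
    pointwise []       = refl
    pointwise (p ∷ ps) = cong₂ _∷_ (ld-functional p (ldA-LDR _)) (pointwise ps)

  ldA-≡ : ∀ u → ldA u ≡ map color (ord u) ∷ concat (map ldA (ord u))
  ldA-≡ u = ldr⇒ldA (ldA-LDR u)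

  root∉removed : All (root ≢_) removed
  root∉removed = All.tabulate λ v∈ root≡v → root-not-removed removal (λ ()) refl (subst (_∈ removed) (sym root≡v) v∈)

  removed-covering : ∀ u → u ∈ removed ⊎ u ≡ root
  removed-covering u
    with unique∧length≡⇒covering (root∉removed ∷ removal-unique removal) (trans (cong suc (removal-length removal)) size-suc) u
  ... | here u≡root = inj₂ u≡root
  ... | there u∈rs  = inj₁ u∈rs

  column-root : column T φ root ≡ (nothing , color root)
  column-root = cong (λ p → Maybe.map φ p , color root) root-parent

  code-≡ : code ≡ map (column T φ) (removed ++ [ root ])
  code-≡ = begin
    map (column T φ) removed ++ [ (nothing , color root) ]   ≡⟨ cong (λ c → map (column T φ) removed ++ [ c ]) column-root ⟨
    map (column T φ) removed ++ map (column T φ) [ root ]    ≡⟨ List.map-++ (column T φ) removed [ root ] ⟨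
    map (column T φ) (removed ++ [ root ])                   ∎
    where open ≡-Reasoning

  code-length : length code ≡ size
  code-length = begin
    length code                                   ≡⟨ List.length-++ (map (column T φ) removed) ⟩
    length (map (column T φ) removed) + 1         ≡⟨ cong (_+ 1) (List.length-map (column T φ) removed) ⟩
    length removed + 1                            ≡⟨ cong (_+ 1) (removal-length removal) ⟩
    (size ∸ 1) + 1                                ≡⟨ +-comm (size ∸ 1) 1 ⟩
    suc (size ∸ 1)                                ≡⟨ size-suc ⟩
    size                                          ∎
    where open ≡-Reasoning

  key : V → SortKey
  key v = color v , ldA v

  ord-sorted : ∀ u → Sorted _≺_ (map key (ord u))
  ord-sorted u = AllPairs.map⁺ (AllPairs.map (λ {a} {b} b-not-before-a → b-not-before-a _ _ (ldA-LDR a) (ldA-LDR b))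
                                             (ValidOrdering.sorted valid u))

module Invariance {T T′ : Arb} (E : Encoding T) (E′ : Encoding T′) (I : ColIso T T′) where
  open Arb
  open ColIso I using (f; bij; edges; colors)
  open Encoding E using (ord; valid)
  open Encoding E′ using () renaming (ord to ord′; valid to valid′)
  open ValidOrdering using (children; distinct)
  private
    module F  = EncodingFacts E
    module F′ = EncodingFacts E′

  f-injective : ∀ {v w} → f v ≡ f w → v ≡ w
  f-injective = Bijection.injective bij

  f⁻¹ : Fin (size T′) → Fin (size T)
  f⁻¹ v′ = proj₁ (Bijection.surjective bij v′)

  f-f⁻¹ : ∀ v′ → f (f⁻¹ v′) ≡ v′
  f-f⁻¹ v′ = proj₂ (Bijection.surjective bij v′) refl

  edge-f⁻¹ : ∀ {u v′} → Edge T′ (f u) v′ → Edge T u (f⁻¹ v′)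
  edge-f⁻¹ {u} {v′} e = Equivalence.from (edges u (f⁻¹ v′)) (subst (Edge T′ (f u)) (sym (f-f⁻¹ v′)) e)

  ord′-f : ∀ u {z} → z ∈ ord′ (f u) ⇔ z ∈ map f (ord u)
  ord′-f u {z} = mk⇔
    (λ z∈ → subst (_∈ map f (ord u)) (f-f⁻¹ z)
      (∈-map⁺ f (Equivalence.from (children valid u (f⁻¹ z)) (edge-f⁻¹ (Equivalence.to (children valid′ (f u) z) z∈)))))
    (λ z∈ → let c , c∈ , z≡fc = ∈-map⁻ f z∈ in
      subst (_∈ ord′ (f u)) (sym z≡fc)
        (Equivalence.from (children valid′ (f u) (f c)) (Equivalence.to (edges u c) (Equivalence.to (children valid u c) c∈))))

  mutual
    ldA-f : ∀ {u xs} → Pre T ord u xs → F′.ldA (f u) ≡ F.ldA u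
    ldA-f {u} (pre ps) = begin
      F′.ldA (f u)                                                    ≡⟨ F′.ldA-≡ (f u) ⟩
      map (color T′) (ord′ (f u)) ∷ concat (map F′.ldA (ord′ (f u)))  ≡⟨ cong₂ (λ cs Ls → cs ∷ concat Ls) (same proj₁) (same proj₂) ⟩
      map (color T) (ord u) ∷ concat (map F.ldA (ord u))              ≡⟨ F.ldA-≡ u ⟨
      F.ldA u                                                         ∎
      where
      open ≡-Reasoning
      children-keys : map F′.key (ord′ (f u)) ↭ map F.key (ord u)
      children-keys = subst (map F′.key (ord′ (f u)) ↭_)
        (trans (sym (List.map-∘ (ord u))) (List.map-cong-local (keys-f ps)))
        (↭-map⁺ F′.key (unique-↭ (distinct valid′ (f u)) (Unique.map⁺ f-injective (distinct valid u)) (ord′-f u)))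
      keys≡ : map F′.key (ord′ (f u)) ≡ map F.key (ord u)
      keys≡ = sorted-↭⇒≡ ≺-≮-antisym children-keys (F′.ord-sorted (f u)) (F.ord-sorted u)
      same : ∀ {B : Set} (π : SortKey → B) → map (λ v → π (F′.key v)) (ord′ (f u)) ≡ map (λ v → π (F.key v)) (ord u)
      same π = trans (List.map-∘ (ord′ (f u))) (trans (cong (map π) keys≡) (sym (List.map-∘ (ord u))))

    keys-f : ∀ {cs xss} → Pointwise (Pre T ord) cs xss → All (λ c → F′.key (f c) ≡ F.key c) cs
    keys-f []       = []
    keys-f (p ∷ ps) = cong₂ _,_ (colors _) (ldA-f p) ∷ keys-f ps

  f-root : f (root T) ≡ root T′
  f-root = Tree.parentless⇒root T′ (f (root T)) parentless
    where
    parentless : parent T′ (f (root T)) ≡ nothing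
    parentless with parent T′ (f (root T)) in e
    ... | nothing = refl
    ... | just p′ with () ← trans (sym (root-parent T))
            (Equivalence.from (edges (f⁻¹ p′) (root T)) (trans e (cong just (sym (f-f⁻¹ p′)))))

  ldA-root : EncodingFacts.ldA E (root T) ≡ EncodingFacts.ldA E′ (root T′)
  ldA-root = trans (sym (ldA-f (F.subtraversal-pre (root T)))) (cong F′.ldA f-root)

  color-root : color T′ (root T′) ≡ color T (root T)
  color-root = trans (cong (color T′) (sym f-root)) (colors (root T))

  size≡ : size T ≡ size T′
  size≡ = Fin.cantor-schröder-bernstein f-injective (Bijection.injective (⤖-sym bij))

module Correspondence {T T′ : Arb} (E : Encoding T) (E′ : Encoding T′) where
  open Arb
  open Encoding E using (ord; valid)
  open Encoding E′ using () renaming (ord to ord′; valid to valid′)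
  private
    module F  = EncodingFacts E
    module F′ = EncodingFacts E′
    V  = Fin (size T)
    V′ = Fin (size T′)

  SameColor : V × V′ → Set
  SameColor (a , a′) = color T′ a′ ≡ color T a

  ParentsIn : List (V × V′) → V × V′ → Set
  ParentsIn Z (a , a′) = ∃₂ λ b b′ → (b , b′) ∈ Z × parent T a ≡ just b × parent T′ a′ ≡ just b′

  Corresponds : V → V′ → List V → List V′ → Set
  Corresponds u u′ xs ys =
    length xs ≡ length ys × All (λ q → SameColor q × (q ≡ (u , u′) ⊎ ParentsIn (zip xs ys) q)) (zip xs ys)

  mutual
    ldA-prefix-free : ∀ {c xs} → Pre T ord c xs → ∀ c′ {R R′} →
      F.ldA c ++ R ≡ F′.ldA c′ ++ R′ → F.ldA c ≡ F′.ldA c′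
    ldA-prefix-free {c} (pre ps) c′ {R} {R′} e = begin
      F.ldA c                                                   ≡⟨ F.ldA-≡ c ⟩
      map (color T) (ord c) ∷ concat (map F.ldA (ord c))        ≡⟨ cong₂ _∷_ heads (ldAs-prefix-free ps (ord′ c′) heads tails) ⟩
      map (color T′) (ord′ c′) ∷ concat (map F′.ldA (ord′ c′))  ≡⟨ F′.ldA-≡ c′ ⟨
      F′.ldA c′                                                 ∎
      where
      open ≡-Reasoning
      unfolded = subst₂ (λ L L′ → L ++ R ≡ L′ ++ R′) (F.ldA-≡ c) (F′.ldA-≡ c′) e
      heads = List.∷-injectiveˡ unfolded
      tails = List.∷-injectiveʳ unfolded

    ldAs-prefix-free : ∀ {cs xss} → Pointwise (Pre T ord) cs xss → ∀ cs′ {R R′} →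
      map (color T) cs ≡ map (color T′) cs′ →
      concat (map F.ldA cs) ++ R ≡ concat (map F′.ldA cs′) ++ R′ → concat (map F.ldA cs) ≡ concat (map F′.ldA cs′)
    ldAs-prefix-free []                 []         _      _ = refl
    ldAs-prefix-free {c ∷ cs} (p ∷ ps) (c′ ∷ cs′) {R} {R′} colors e =
      cong₂ _++_ first (ldAs-prefix-free ps cs′ (List.∷-injectiveʳ colors) rest)
      where
      reassociated : F.ldA c ++ (concat (map F.ldA cs) ++ R) ≡ F′.ldA c′ ++ (concat (map F′.ldA cs′) ++ R′)
      reassociated = trans (sym (List.++-assoc (F.ldA c) _ R)) (trans e (List.++-assoc (F′.ldA c′) _ R′))
      first = ldA-prefix-free p c′ reassociated
      rest  = List.++-cancelˡ (F′.ldA c′) _ _ (subst (λ L → L ++ _ ≡ _) first reassociated)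

  private
    descendants : List V → List V
    descendants cs = concat (map F.subtraversal cs)

    descendants′ : List V′ → List V′
    descendants′ cs′ = concat (map F′.subtraversal cs′)

  mutual
    subtraversal-corresponds : ∀ {u xs} → Pre T ord u xs → ∀ u′ → F.ldA u ≡ F′.ldA u′ → SameColor (u , u′) →
      Corresponds u u′ (F.subtraversal u) (F′.subtraversal u′)
    subtraversal-corresponds {u} (pre ps) u′ ld≡ same =
      subst₂ (Corresponds u u′) (sym (F.subtraversal-≡ u)) (sym (F′.subtraversal-≡ u′))
        (cong suc (proj₁ below) , (same , inj₁ refl) ∷ All.map (λ (same , parents) → same , inj₂ parents) (proj₂ below))
      where
      unfolded = trans (sym (F.ldA-≡ u)) (trans ld≡ (F′.ldA-≡ u′))
      below = children-correspond ps (ord′ u′) (List.∷-injectiveˡ unfolded) (List.∷-injectiveʳ unfolded)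
                (All.tabulate F.child-parent) (All.tabulate F′.child-parent) (here refl) there

    children-correspond : ∀ {u u′ cs xss} → Pointwise (Pre T ord) cs xss → ∀ cs′ →
      map (color T) cs ≡ map (color T′) cs′ → concat (map F.ldA cs) ≡ concat (map F′.ldA cs′) →
      All (λ c → parent T c ≡ just u) cs → All (λ c′ → parent T′ c′ ≡ just u′) cs′ →
      ∀ {Z} → (u , u′) ∈ Z → (∀ {q} → q ∈ zip (descendants cs) (descendants′ cs′) → q ∈ Z) →
      length (descendants cs) ≡ length (descendants′ cs′) ×
      All (λ q → SameColor q × ParentsIn Z q) (zip (descendants cs) (descendants′ cs′))
    children-correspond []       []      _  _ [] [] _ _ = refl , []
    children-correspond []       (_ ∷ _) () _ _  _  _ _
    children-correspond (_ ∷ _)  []      () _ _  _  _ _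
    children-correspond {u} {u′} {c ∷ cs} (p ∷ ps) (c′ ∷ cs′) colors lds (pc ∷ pcs) (pc′ ∷ pcs′) {Z} uu′∈Z ⊆Z =
      lengths , subst (All _) (sym zip≡) (++⁺ (All.map lift (proj₂ first)) (proj₂ rest))
      where
      first-ld = ldA-prefix-free p c′ lds
      rest-ld  = List.++-cancelˡ (F′.ldA c′) _ _ (subst (λ L → L ++ _ ≡ _) first-ld lds)
      first    = subtraversal-corresponds p c′ first-ld (sym (List.∷-injectiveˡ colors))
      zip≡ : zip (F.subtraversal c ++ descendants cs) (F′.subtraversal c′ ++ descendants′ cs′)
           ≡ zip (F.subtraversal c) (F′.subtraversal c′) ++ zip (descendants cs) (descendants′ cs′)
      zip≡ = zip-++ (F.subtraversal c) (F′.subtraversal c′) (proj₁ first)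
      rest = children-correspond ps cs′ (List.∷-injectiveʳ colors) rest-ld pcs pcs′ uu′∈Z
               (λ q∈ → ⊆Z (subst (_ ∈_) (sym zip≡) (∈-++⁺ʳ _ q∈)))
      lift : ∀ {q} → SameColor q × (q ≡ (c , c′) ⊎ ParentsIn (zip (F.subtraversal c) (F′.subtraversal c′)) q) →
        SameColor q × ParentsIn Z q
      lift (same , inj₁ refl)                       = same , u , u′ , uu′∈Z , pc , pc′
      lift (same , inj₂ (b , b′ , bb′∈ , pb , pb′)) =
        same , b , b′ , ⊆Z (subst (_ ∈_) (sym zip≡) (∈-++⁺ˡ bb′∈)) , pb , pb′
      lengths = trans (List.length-++ (F.subtraversal c))
        (trans (cong₂ _+_ (proj₁ first) (proj₁ rest)) (sym (List.length-++ (F′.subtraversal c′))))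

  traversals-correspond : F.ldA (root T) ≡ F′.ldA (root T′) → SameColor (root T , root T′) →
    Corresponds (root T) (root T′) (Encoding.traversal E) (Encoding.traversal E′)
  traversals-correspond ld≡ same =
    subst₂ (Corresponds (root T) (root T′)) F.subtraversal-root F′.subtraversal-root
      (subtraversal-corresponds (F.subtraversal-pre (root T)) (root T′) ld≡ same)

module Relabelling {T T′ : Arb} (E : Encoding T) (E′ : Encoding T′) (n≡n′ : Arb.size T ≡ Arb.size T′) where
  open Arb
  open Encoding E using (φ; removed; removal; code)
  open Encoding E′ using () renaming (φ to φ′; removed to removed′; removal to removal′; code to code′)
  private
    module F  = EncodingFacts E
    module F′ = EncodingFacts E′

  private
    φ<size′ : ∀ v → φ v < size T′
    φ<size′ v = subst (φ v <_) n≡n′ (F.φ<size v)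

    φ′<size : ∀ v′ → φ′ v′ < size T
    φ′<size v′ = subst (φ′ v′ <_) (sym n≡n′) (F′.φ<size v′)

  relabel : Fin (size T) → Fin (size T′)
  relabel v = F′.vertex (φ v) (φ<size′ v)

  relabel⁻¹ : Fin (size T′) → Fin (size T)
  relabel⁻¹ v′ = F.vertex (φ′ v′) (φ′<size v′)

  φ′-relabel : ∀ v → φ′ (relabel v) ≡ φ v
  φ′-relabel v = F′.φ-vertex (φ v) (φ<size′ v)

  φ-relabel⁻¹ : ∀ v′ → φ (relabel⁻¹ v′) ≡ φ′ v′
  φ-relabel⁻¹ v′ = F.φ-vertex (φ′ v′) (φ′<size v′)

  relabel-injective : ∀ {v w} → relabel v ≡ relabel w → v ≡ w
  relabel-injective {v} {w} e = F.φ-injective (trans (sym (φ′-relabel v)) (trans (cong φ′ e) (φ′-relabel w)))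

  relabel-relabel⁻¹ : ∀ v′ → relabel (relabel⁻¹ v′) ≡ v′
  relabel-relabel⁻¹ v′ = F′.φ-injective (trans (φ′-relabel _) (φ-relabel⁻¹ v′))

  ∀-relabel : {P : Fin (size T′) → Set} → (∀ v → P (relabel v)) → ∀ v′ → P v′
  ∀-relabel {P} P-relabel v′ = subst P (relabel-relabel⁻¹ v′) (P-relabel (relabel⁻¹ v′))

  ∈-map-relabel⁻ : ∀ {v G} → relabel v ∈ map relabel G → v ∈ G
  ∈-map-relabel⁻ {v} {G} rv∈ with w , w∈G , rv≡rw ← ∈-map⁻ relabel rv∈ =
    subst (_∈ G) (sym (relabel-injective rv≡rw)) w∈G

  relabel-root : relabel (root T) ≡ root T′
  relabel-root = F′.φ-injective (trans (φ′-relabel _) (trans F.φ-root (sym F′.φ-root)))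

  code′-relabel : removed′ ≡ map relabel removed → code′ ≡ map (column T′ φ′ ∘ relabel) (removed ++ [ root T ])
  code′-relabel removed′≡ = begin
    code′
      ≡⟨ F′.code-≡ ⟩
    map (column T′ φ′) (removed′ ++ [ root T′ ])
      ≡⟨ cong₂ (λ rs r → map (column T′ φ′) (rs ++ [ r ])) removed′≡ (sym relabel-root) ⟩
    map (column T′ φ′) (map relabel removed ++ [ relabel (root T) ])
      ≡⟨ cong (map (column T′ φ′)) (List.map-++ relabel removed [ root T ]) ⟨
    map (column T′ φ′) (map relabel (removed ++ [ root T ]))
      ≡⟨ List.map-∘ (removed ++ [ root T ]) ⟨
    map (column T′ φ′ ∘ relabel) (removed ++ [ root T ])
      ∎
    where open ≡-Reasoning

  record IsIsomorphism : Set where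
    field
      parent-relabel : ∀ v → parent T′ (relabel v) ≡ Maybe.map relabel (parent T v)
      color-relabel  : ∀ v → color T′ (relabel v) ≡ color T v

  column-relabel⇒isomorphism : (∀ v → column T′ φ′ (relabel v) ≡ column T φ v) → IsIsomorphism
  column-relabel⇒isomorphism same = record
    { parent-relabel = λ v → Maybe.map-injective F′.φ-injective (begin
        Maybe.map φ′ (parent T′ (relabel v))              ≡⟨ cong proj₁ (same v) ⟩
        Maybe.map φ (parent T v)                          ≡⟨ Maybe.map-cong (λ w → sym (φ′-relabel w)) (parent T v) ⟩
        Maybe.map (λ w → φ′ (relabel w)) (parent T v)     ≡⟨ Maybe.map-∘ (parent T v) ⟩
        Maybe.map φ′ (Maybe.map relabel (parent T v))     ∎)
    ; color-relabel = λ v → cong proj₂ (same v)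
    }
    where open ≡-Reasoning

  module _ (iso : IsIsomorphism) where
    open IsIsomorphism iso

    column-relabel : ∀ v → column T′ φ′ (relabel v) ≡ column T φ v
    column-relabel v = cong₂ _,_ (begin
        Maybe.map φ′ (parent T′ (relabel v))              ≡⟨ cong (Maybe.map φ′) (parent-relabel v) ⟩
        Maybe.map φ′ (Maybe.map relabel (parent T v))     ≡⟨ sym (Maybe.map-∘ (parent T v)) ⟩
        Maybe.map (λ w → φ′ (relabel w)) (parent T v)     ≡⟨ Maybe.map-cong φ′-relabel (parent T v) ⟩
        Maybe.map φ (parent T v)                          ∎)
      (color-relabel v)
      where open ≡-Reasoning

    edge-relabel : ∀ u v → Edge T u v ⇔ Edge T′ (relabel u) (relabel v)
    edge-relabel u v = mk⇔
      (λ pv → trans (parent-relabel v) (cong (Maybe.map relabel) pv))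
      (λ pv′ → Maybe.map-injective relabel-injective (trans (sym (parent-relabel v)) pv′))

    toColIso : ColIso T T′
    toColIso = record
      { bij    = mk⤖ ((λ {v} {w} → relabel-injective) , λ v′ → relabel⁻¹ v′ , λ where refl → relabel-relabel⁻¹ v′)
      ; edges  = edge-relabel
      ; colors = color-relabel
      }

    leaf-relabel : ∀ {G v} → IsLeafIn T G v ⇔ IsLeafIn T′ (map relabel G) (relabel v)
    leaf-relabel {G} {v} = mk⇔
      (λ (v∉G , children-gone) → (λ rv∈ → v∉G (∈-map-relabel⁻ rv∈)) ,
        ∀-relabel (λ w e → ∈-map⁺ relabel (children-gone w (Equivalence.from (edge-relabel v w) e))))
      (λ (rv∉ , children-gone′) → (λ v∈G → rv∉ (∈-map⁺ relabel v∈G)) ,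
        λ w e → ∈-map-relabel⁻ (children-gone′ (relabel w) (Equivalence.to (edge-relabel v w) e)))

    removal-relabel : ∀ {G k rs} → Removal T φ G k rs → Removal T′ φ′ (map relabel G) k (map relabel rs)
    removal-relabel done = done
    removal-relabel {G} (step v leaf min r) =
      step (relabel v) (Equivalence.to leaf-relabel leaf) min′ (removal-relabel r)
      where
      min′ : ∀ w′ → IsLeafIn T′ (map relabel G) w′ → φ′ (relabel v) ≤ φ′ w′
      min′ = ∀-relabel λ w leaf′ →
        subst₂ _≤_ (sym (φ′-relabel v)) (sym (φ′-relabel w)) (min w (Equivalence.from leaf-relabel leaf′))

    code≡code′ : code ≡ code′
    code≡code′ = begin
      code                                                        ≡⟨ F.code-≡ ⟩
      map (column T φ) (removed ++ [ root T ])                    ≡⟨ List.map-cong column-relabel (removed ++ [ root T ]) ⟨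
      map (column T′ φ′ ∘ relabel) (removed ++ [ root T ])        ≡⟨ code′-relabel removed′≡ ⟨
      code′                                                       ∎
      where
      open ≡-Reasoning
      removed′≡ : removed′ ≡ map relabel removed
      removed′≡ = Tree.removal-deterministic T′ F′.φ-injective removal′
        (subst (λ k → Removal T′ φ′ [] k (map relabel removed)) (cong (_∸ 1) n≡n′) (removal-relabel removal))

  correspondence⇒isomorphism :
    Correspondence.Corresponds E E′ (root T) (root T′) (Encoding.traversal E) (Encoding.traversal E′) → IsIsomorphism
  correspondence⇒isomorphism (_ , matched) = record
    { parent-relabel = parent-relabel
    ; color-relabel  = λ v → proj₁ (pair v)
    }
    where
    open Encoding E using (traversal; φ-position)
    open Encoding E′ using () renaming (traversal to traversal′; φ-position to φ′-position)
    open Correspondence E E′ using (SameColor; ParentsIn)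
    Z = zip traversal traversal′

    ∈Z : ∀ v → (v , relabel v) ∈ Z
    ∈Z v with i , tᵢ≡v , i≡φv ← φ-position v | j , t′ⱼ≡rv , j≡φ′rv ← φ′-position (relabel v) =
      subst₂ (λ a b → (a , b) ∈ Z) tᵢ≡v t′ⱼ≡rv
        (∈-zip-lookup traversal traversal′ i j (trans i≡φv (trans (sym (φ′-relabel v)) (sym j≡φ′rv))))

    ∈Z⇒relabel : ∀ {b b′} → (b , b′) ∈ Z → b′ ≡ relabel b
    ∈Z⇒relabel {b} {b′} bb′∈ with i , j , i≡j , tᵢ≡b , t′ⱼ≡b′ ← ∈-zip⁻ traversal traversal′ bb′∈ =
      F′.φ-injective (trans (F′.φ-lookup j t′ⱼ≡b′)
        (trans (sym i≡j) (trans (sym (F.φ-lookup i tᵢ≡b)) (sym (φ′-relabel b)))))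

    pair : ∀ v → SameColor (v , relabel v) × ((v , relabel v) ≡ (root T , root T′) ⊎ ParentsIn Z (v , relabel v))
    pair v = All.lookup matched (∈Z v)

    parent-relabel : ∀ v → parent T′ (relabel v) ≡ Maybe.map relabel (parent T v)
    parent-relabel v with pair v
    ... | _ , inj₁ at-root = begin
      parent T′ (relabel v)                ≡⟨ cong (parent T′) (cong proj₂ at-root) ⟩
      parent T′ (root T′)                  ≡⟨ root-parent T′ ⟩
      nothing                              ≡⟨ cong (Maybe.map relabel) (root-parent T) ⟨
      Maybe.map relabel (parent T (root T)) ≡⟨ cong (Maybe.map relabel ∘ parent T) (cong proj₁ at-root) ⟨
      Maybe.map relabel (parent T v)        ∎
      where open ≡-Reasoning
    ... | _ , inj₂ (b , b′ , bb′∈ , pv , prv) =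
      trans prv (trans (cong just (∈Z⇒relabel bb′∈)) (sym (cong (Maybe.map relabel) pv)))

  first-removed-≤ : ∀ {G G′ k k′ v v′ rs rs′} →
    Removal T φ G k (v ∷ rs) → Removal T′ φ′ G′ k′ (v′ ∷ rs′) →
    map φ G ≡ map φ′ G′ → map (column T φ) (v ∷ rs) ≡ map (column T′ φ′) (v′ ∷ rs′) →
    Tree.Exhaust T G (v ∷ rs) → φ v ≤ φ′ v′
  first-removed-≤ {G} {G′} (step v _ min _) R′@(step v′ (v′∉G′ , v′-children-gone) _ _) gone≡ columns≡ exhaust =
    subst (φ v ≤_) (φ-relabel⁻¹ v′) (min w (w∉G , w-children-gone))
    where
    w = relabel⁻¹ v′

    w∉G : w ∉ G
    w∉G w∈G with y , y∈G′ , φ′y≡φw ← map-≡⇒∈ gone≡ w∈G =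
      v′∉G′ (subst (_∈ G′) (F′.φ-injective (trans φ′y≡φw (φ-relabel⁻¹ v′))) y∈G′)

    -- A child x of w still present occurs in a column whose parent label is φ w = φ′ v′;
    -- the vertex of T′ in the same column would be a child of v′ still present.
    w-children-gone : ∀ x → Edge T w x → x ∈ G
    w-children-gone x px with exhaust x
    ... | inj₁ x∈G         = x∈G
    ... | inj₂ (inj₂ refl) with () ← trans (sym (root-parent T)) px
    ... | inj₂ (inj₁ x∈)   with x′ , x′∈ , column≡ ← map-≡⇒∈ columns≡ x∈ =
      ⊥-elim (All.lookup (Tree.removal-fresh T′ R′) x′∈ (v′-children-gone x′ px′))
      where
      px′ : parent T′ x′ ≡ just v′
      px′ = Maybe.map-injective F′.φ-injective
        (trans (cong proj₁ column≡) (trans (cong (Maybe.map φ) px) (cong just (φ-relabel⁻¹ v′))))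

module Decoding {T T′ : Arb} (E : Encoding T) (E′ : Encoding T′) (n≡n′ : Arb.size T ≡ Arb.size T′) where
  open Arb
  open Encoding E using (φ; removed; removal; code)
  open Encoding E′ using () renaming (φ to φ′; removed to removed′; removal to removal′; code to code′)
  open Relabelling E E′ n≡n′
  private
    module F    = EncodingFacts E
    module F′   = EncodingFacts E′
    module Back = Relabelling E′ E (sym n≡n′)

  removal-labels : ∀ {G G′ k k′ rs rs′} → Removal T φ G k rs → Removal T′ φ′ G′ k′ rs′ →
    map φ G ≡ map φ′ G′ → map (column T φ) rs ≡ map (column T′ φ′) rs′ →
    Tree.Exhaust T G rs → Tree.Exhaust T′ G′ rs′ → map φ rs ≡ map φ′ rs′
  removal-labels done             done               _      _        _       _        = refl
  removal-labels done             (step _ _ _ _)     _      ()       _       _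
  removal-labels (step _ _ _ _)   done               _      ()       _       _
  removal-labels R@(step _ _ _ r) R′@(step _ _ _ r′) gone≡ columns≡ exhaust exhaust′ =
    cong₂ _∷_ first≡ (removal-labels r r′ (cong₂ _∷_ first≡ gone≡) (List.∷-injectiveʳ columns≡)
                        (Tree.exhaust-step T exhaust) (Tree.exhaust-step T′ exhaust′))
    where
    first≡ = ≤-antisym (first-removed-≤ R R′ gone≡ columns≡ exhaust)
                       (Back.first-removed-≤ R′ R (sym gone≡) (sym columns≡) exhaust′)

  code≡⇒isomorphism : code ≡ code′ → IsIsomorphism
  code≡⇒isomorphism code≡code′ = column-relabel⇒isomorphism λ v → sym (map-≡⇒≗ columns≡ (everyone v))
    where
    columns≡ : map (column T φ) (removed ++ [ root T ]) ≡ map (column T′ φ′ ∘ relabel) (removed ++ [ root T ])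
    columns≡ = trans (sym F.code-≡) (trans code≡code′ (code′-relabel removed′≡))
      where
      removed-columns≡ : map (column T φ) removed ≡ map (column T′ φ′) removed′
      removed-columns≡ = List.∷ʳ-injectiveˡ _ _ code≡code′
      labels≡ : map φ removed ≡ map φ′ removed′
      labels≡ = removal-labels removal removal′ refl removed-columns≡
        (λ u → inj₂ (F.removed-covering u)) (λ u → inj₂ (F′.removed-covering u))
      removed′≡ : removed′ ≡ map relabel removed
      removed′≡ = List.map-injective F′.φ-injective
        (trans (sym labels≡) (trans (List.map-cong (λ v → sym (φ′-relabel v)) removed) (List.map-∘ removed)))

    everyone : ∀ v → v ∈ removed ++ [ root T ]
    everyone v with F.removed-covering v
    ... | inj₁ v∈removed = ∈-++⁺ˡ v∈removed
    ... | inj₂ refl      = ∈-++⁺ʳ removed (here refl)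

ColIso⇒code≡ : ∀ {T T′} (E : Encoding T) (E′ : Encoding T′) → ColIso T T′ → Encoding.code E ≡ Encoding.code E′
ColIso⇒code≡ E E′ I =
  code≡code′ (correspondence⇒isomorphism (Correspondence.traversals-correspond E E′ ldA-root color-root))
  where
  open Invariance E E′ I using (ldA-root; color-root; size≡)
  open Relabelling E E′ size≡

code≡⇒ColIso : ∀ {T T′} (E : Encoding T) (E′ : Encoding T′) → Encoding.code E ≡ Encoding.code E′ → ColIso T T′
code≡⇒ColIso E E′ code≡code′ = toColIso (code≡⇒isomorphism code≡code′)
  where
  size≡ = trans (sym (EncodingFacts.code-length E)) (trans (cong length code≡code′) (EncodingFacts.code-length E′))
  open Relabelling E E′ size≡ using (toColIso)
  open Decoding E E′ size≡ using (code≡⇒isomorphism)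

theorem4p3 : (T T' : Arb) (P P' : List (Maybe ℕ × ℕ)) →
    IsVCPC T P → IsVCPC T' P' → (ColIso T T' ⇔ (P ≡ P'))
theorem4p3 T T' P P' vcpc vcpc'
  with E , P≡code ← IsVCPC⇒Encoding vcpc | E′ , P′≡code′ ← IsVCPC⇒Encoding vcpc' = mk⇔
  (λ iso → trans P≡code (trans (ColIso⇒code≡ E E′ iso) (sym P′≡code′)))
  (λ P≡P′ → code≡⇒ColIso E E′ (trans (sym P≡code) (trans P≡P′ P′≡code′)))
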